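{- Let $\mathcal{D}_h$ be a sound abstraction of $\mathcal{D}_l$ relative to a refinement mapping $m$. Then for any ground high-level action sequence $\vec\alpha$ and any high-level situation-suppressed formula $\phi$: if $\mathcal{D}_h\models Executable(do(\vec\alpha,S_0))\land\phi[do(\vec\alpha,S_0)]$, then $\mathcal{D}_l\cup\mathcal{C}\models\exists s.\,Do(m(\vec\alpha),S_0,s)\land m(\phi)[s]$.
   Context: Situation calculus setting. Objects are a countably infinite set $\mathcal{N}$ of standard names (unique names and domain closure); no function symbols other than constants; no non-fluent predicates. Situations: $S_0$ and $do(a,s)$; $do([a_1,\dots,a_n],s)$ abbreviates $do(a_n,\dots,do(a_1,s)\dots)$, also written $do(\vec a,s)$. $Poss(a,s)$ means $a$ is executable in $s$; $Executable(s)$ means every action along the history from $S_0$ to $s$ was possible where performed. A basic action theory (BAT) over finitely many action types $\mathcal{A}$ and fluents $\mathcal{F}$ consists of initial-state axioms $\mathcal{D}_{S_0}$, precondition axioms $Poss(A(\vec x),s)\equiv\phi^{Poss}_A(\vec x,s)$, successor state axioms $F(\vec x,do(a,s))\equiv\phi^{ssa}_F(\vec x,a,s)$ (right-hand sides uniform in $s$), unique names/domain closure axioms for actions $\mathcal{D}_{ca}$ and for objects $\mathcal{D}_{coa}$, and foundational axioms $\Sigma$. A situation-suppressed formula omits situation arguments of fluents; $\phi[s]$ restores $s$. ConGolog programs $\delta::=\alpha\mid\varphi?\mid\delta_1;\delta_2\mid\delta_1|\delta_2\mid\pi x.\delta\mid\delta^*\mid\delta_1\|\delta_2$, $nil=True?$;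 $\mathcal{C}$ are the axioms: $Trans(\alpha,s,\delta',s')\equiv s'=do(\alpha,s)\land Poss(\alpha,s)\land\delta'=True?$; $Trans(\varphi?,s,\delta',s')\equiv False$; $Trans(\delta_1;\delta_2,s,\delta',s')\equiv\exists\delta_1'(Trans(\delta_1,s,\delta_1',s')\land\delta'=\delta_1';\delta_2)\lor(Final(\delta_1,s)\land Trans(\delta_2,s,\delta',s'))$; $Trans(\delta_1|\delta_2,\cdot)\equiv Trans(\delta_1,\cdot)\lor Trans(\delta_2,\cdot)$; $Trans(\pi x.\delta,s,\delta',s')\equiv\exists x.Trans(\delta,s,\delta',s')$; $Trans(\delta^*,s,\delta',s')\equiv\exists\delta''(Trans(\delta,s,\delta'',s')\land\delta'=\delta'';\delta^*)$; $Trans(\delta_1\|\delta_2,s,\delta',s')\equiv\exists\delta_1'(Trans(\delta_1,s,\delta_1',s')\land\delta'=\delta_1'\|\delta_2)\lor\exists\delta_2'(Trans(\delta_2,s,\delta_2',s')\land\delta'=\delta_1\|\delta_2')$; $Final(\alpha,s)\equiv False$; $Final(\varphi?,s)\equiv\varphi[s]$; $Final(\delta_1;\delta_2,s)\equiv Final(\delta_1,s)\land Final(\delta_2,s)$; $Final(\delta_1|\delta_2,s)\equiv Final(\delta_1,s)\lor Final(\delta_2,s)$; $Final(\pi x.\delta,s)\equiv\exists x.Final(\delta,s)$; $Final(\delta^*,s)\equiv True$; $Final(\delta_1\|\delta_2,s)\equiv Final(\delta_1,s)\land Final(\delta_2,s)$. $Do(\delta,s,s')\doteq\exists\delta'.Trans^*(\delta,s,\delta',s')\land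 Final(\delta',s')$, $Trans^*$ the reflexive transitive closure. $\mathcal{D}_h$ (high-level) and $\mathcal{D}_l$ (low-level) are BATs with action types $\mathcal{A}_h,\mathcal{A}_l$ and fluents $\mathcal{F}_h,\mathcal{F}_l$, sharing only $\mathcal{N}$. A refinement mapping $m$ maps each $A\in\mathcal{A}_h$ to a situation-determined ConGolog program $m(A(\vec x))$ over $\mathcal{D}_l$ with free variables $\vec x$, and each $F\in\mathcal{F}_h$ to a situation-suppressed low-level formula $m(F(\vec x))$; $m(\phi)$ substitutes $m(F(\vec x))$ for fluent atoms; $m(\alpha_1,\dots,\alpha_n)=m(\alpha_1);\dots;m(\alpha_n)$, $m(\epsilon)=nil$. For a model $M_h$ of $\mathcal{D}_h$ and a model $M_l$ of $\mathcal{D}_l\cup\mathcal{C}$: $s_h\simeq_m^{M_h,M_l}s_l$ iff for all $F\in\mathcal{F}_h$ and assignments $v$, $M_h,v[s/s_h]\models F(\vec x,s)$ iff $M_l,v[s/s_l]\models m(F(\vec x))[s]$. A relation $B$ between situation domains is an $m$-bisimulation if each $\langle s_h,s_l\rangle\in B$ satisfies: (1) $s_h\simeq_m^{M_h,M_l}s_l$; (2) for each $A\in\mathcal{A}_h$ and $v$, if some $s_h'$ has $M_h,v[s/s_h,s'/s_h']\models Poss(A(\vec x),s)\land s'=do(A(\vec x),s)$ then some $s_l'$ has $M_l,v[s/s_l,s'/s_l']\models Do(m(A(\vec x)),s,s')$ and $\langle s_h',s_l'\rangle\in B$; (3) conversely, if some $s_l'$ has $M_l,v[s/s_l,s'/s_l']\models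 Do(m(A(\vec x)),s,s')$ then some $s_h'$ has $M_h,v[s/s_h,s'/s_h']\models Poss(A(\vec x),s)\land s'=do(A(\vec x),s)$ and $\langle s_h',s_l'\rangle\in B$. $M_h\sim_m M_l$ iff some $m$-bisimulation contains $\langle S_0^{M_h},S_0^{M_l}\rangle$. $\mathcal{D}_h$ is a sound abstraction of $\mathcal{D}_l$ relative to $m$ iff for every model $M_l$ of $\mathcal{D}_l\cup\mathcal{C}$ there is a model $M_h$ of $\mathcal{D}_h$ with $M_h\sim_m M_l$. -}

module Defs where

open import Data.Nat using (ℕ; zero; suc)
open import Data.Fin using (Fin; zero; suc)
open import Data.Vec using (Vec; []; _∷_; lookup; map)
open import Data.List using (List; []; _∷_)
open import Data.Product using (Σ; _×_) renaming (_,_ to _,,_)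
open import Data.Sum using (_⊎_)
open import Data.Unit using (⊤)
open import Data.Empty using (⊥)
open import Level using (Level) renaming (suc to lsuc; zero to lzero)
open import Relation.Binary.PropositionalEquality using (_≡_)

-- Signatures of a basic action theory.
-- Objects are the standard names ℕ (unique names + domain closure).
-- Finitely many action types (Fin nA) and fluents (Fin nF), with arities.

record Sig : Set where
  field
    nA     : ℕ
    aArity : Fin nA → ℕ
    nF     : ℕ
    fArity : Fin nF → ℕ
open Sig public

-- Ground actions A(c⃗): by unique names / domain closure for actions the
-- action domain is exactly the set of such terms.
record Act (S : Sig) : Set where
  constructor _,_
  field
    aType : Fin (nA S)
    aArgs : Vec ℕ (aArity S aType)

-- Situations: by the foundational axioms Σ the situation domain is the
-- tree of finite action sequences; do(a,s) = a ∷ s, S0 = [].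
Sit : Sig → Set
Sit S = List (Act S)

S0 : {S : Sig} → Sit S
S0 = []

doA : {S : Sig} → Act S → Sit S → Sit S
doA a s = a ∷ s

doSeq : {S : Sig} → List (Act S) → Sit S → Sit S
doSeq []       s = s
doSeq (a ∷ as) s = doSeq as (doA a s)

data Tm (n : ℕ) : Set where
  var : Fin n → Tm n
  nm  : ℕ → Tm n

Env : ℕ → Set
Env n = Fin n → ℕ

ext : {n : ℕ} → Env n → ℕ → Env (suc n)
ext ρ c zero    = c
ext ρ c (suc i) = ρ i

evalT : {n : ℕ} → Tm n → Env n → ℕ
evalT (var i) ρ = ρ i
evalT (nm c)  ρ = c

Subst : ℕ → ℕ → Set
Subst n m = Fin n → Tm m

wkT : {n : ℕ} → Tm n → Tm (suc n)
wkT (var i) = var (suc i)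
wkT (nm c)  = nm c

liftS : {n m : ℕ} → Subst n m → Subst (suc n) (suc m)
liftS σ zero    = var zero
liftS σ (suc i) = wkT (σ i)

substT : {n m : ℕ} → Tm n → Subst n m → Tm m
substT (var i) σ = σ i
substT (nm c)  σ = nm c

-- First-order formulas (object sort), generic in the atoms.
-- ∨, ⊃, ∀ are the usual abbreviations.

data Fm (At : ℕ → Set) (n : ℕ) : Set where
  true : Fm At n
  atom : At n → Fm At n
  ¬'_  : Fm At n → Fm At n
  _∧'_ : Fm At n → Fm At n → Fm At n
  ∃'   : Fm At (suc n) → Fm At n

⟦_⟧ : {At : ℕ → Set} {n : ℕ} → Fm At n →
      (∀ {k} → At k → Env k → Set) → Env n → Set
⟦ true ⟧    I ρ = ⊤
⟦ atom a ⟧  I ρ = I a ρ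
⟦ ¬' φ ⟧    I ρ = ⟦ φ ⟧ I ρ → ⊥
⟦ φ ∧' ψ ⟧  I ρ = ⟦ φ ⟧ I ρ × ⟦ ψ ⟧ I ρ
⟦ ∃' φ ⟧    I ρ = Σ ℕ (λ c → ⟦ φ ⟧ I (ext ρ c))

substFm : {At : ℕ → Set} →
          (∀ {k l} → At k → Subst k l → At l) →
          {n m : ℕ} → Fm At n → Subst n m → Fm At m
substFm sA true       σ = true
substFm sA (atom a)   σ = atom (sA a σ)
substFm sA (¬' φ)     σ = ¬' substFm sA φ σ
substFm sA (φ ∧' ψ)   σ = substFm sA φ σ ∧' substFm sA ψ σ
substFm sA (∃' φ)     σ = ∃' (substFm sA φ (liftS σ))

data HAtom (S : Sig) (n : ℕ) : Set where
  flu : (F : Fin (nF S)) → Vec (Tm n) (fArity S F) → HAtom S n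
  eq  : Tm n → Tm n → HAtom S n

SFm : Sig → ℕ → Set
SFm S = Fm (HAtom S)

substHA : {S : Sig} {k l : ℕ} → HAtom S k → Subst k l → HAtom S l
substHA (flu F ts) σ = flu F (map (λ t → substT t σ) ts)
substHA (eq t u)   σ = eq (substT t σ) (substT u σ)

-- Atoms of successor-state-axiom right-hand sides: additionally
-- "a = A(t⃗)" for the distinguished action variable a.  (With unique
-- names and domain closure for actions, quantification over actions is
-- expressible as a finite disjunction over action types, so this loses
-- no expressiveness.)
data SSAAtom (S : Sig) (n : ℕ) : Set where
  base  : HAtom S n → SSAAtom S n
  isAct : (A : Fin (nA S)) → Vec (Tm n) (aArity S A) → SSAAtom S n

record Model (S : Sig) : Set₁ where
  field
    Flu  : (F : Fin (nF S)) → Vec ℕ (fArity S F) → Sit S → Set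
    Poss : Act S → Sit S → Set
open Model public

evalV : {n k : ℕ} → Vec (Tm n) k → Env n → Vec ℕ k
evalV ts ρ = map (λ t → evalT t ρ) ts

holdsHA : {S : Sig} → Model S → Sit S → {k : ℕ} → HAtom S k → Env k → Set
holdsHA M s (flu F ts) ρ = Flu M F (evalV ts ρ) s
holdsHA M s (eq t u)   ρ = evalT t ρ ≡ evalT u ρ

holds : {S : Sig} {n : ℕ} → Model S → SFm S n → Sit S → Env n → Set
holds M φ s ρ = ⟦ φ ⟧ (holdsHA M s) ρ

holdsSSA : {S : Sig} → Model S → Act S → Sit S →
           {k : ℕ} → SSAAtom S k → Env k → Set
holdsSSA M a s (base h)     ρ = holdsHA M s h ρ
holdsSSA M a s (isAct A ts) ρ = a ≡ (A , evalV ts ρ)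

tabEnv : {k : ℕ} → Vec ℕ k → Env k
tabEnv xs i = lookup xs i

_↔_ : Set → Set → Set
P ↔ Q = (P → Q) × (Q → P)

-- D_ca, D_coa and Σ are built into the canonical
-- domains above; a BAT is given by D_S0 (an arbitrary set of
-- situation-suppressed sentences), the precondition formulas φ^Poss_A(x⃗)
-- and the successor-state formulas φ^ssa_F(x⃗, a).

record BAT (S : Sig) : Set₁ where
  field
    DS0 : SFm S 0 → Set
    pre : (A : Fin (nA S)) → SFm S (aArity S A)
    ssa : (F : Fin (nF S)) → Fm (SSAAtom S) (fArity S F)
open BAT public

record _⊨BAT_ {S : Sig} (M : Model S) (D : BAT S) : Set where
  field
    initial : (φ : SFm S 0) → DS0 D φ → holds M φ S0 (λ ())
    precond : (A : Fin (nA S)) (xs : Vec ℕ (aArity S A)) (s : Sit S) →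
              Poss M (A , xs) s ↔ holds M (pre D A) s (tabEnv xs)
    succst  : (F : Fin (nF S)) (xs : Vec ℕ (fArity S F)) (a : Act S) (s : Sit S) →
              Flu M F xs (doA a s) ↔ ⟦ ssa D F ⟧ (holdsSSA M a s) (tabEnv xs)

Executable : {S : Sig} → Model S → Sit S → Set
Executable M []      = ⊤
Executable M (a ∷ s) = Executable M s × Poss M a s

data Prog (S : Sig) (n : ℕ) : Set where
  act  : (A : Fin (nA S)) → Vec (Tm n) (aArity S A) → Prog S n
  test : SFm S n → Prog S n
  _︔_  : Prog S n → Prog S n → Prog S n
  _∣_  : Prog S n → Prog S n → Prog S n
  πx   : Prog S (suc n) → Prog S n
  _*   : Prog S n → Prog S n
  _∥_  : Prog S n → Prog S n → Prog S n

nil : {S : Sig} {n : ℕ} → Prog S n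
nil = test true

substP : {S : Sig} {n m : ℕ} → Prog S n → Subst n m → Prog S m
substP (act A ts) σ = act A (map (λ t → substT t σ) ts)
substP (test φ)   σ = test (substFm substHA φ σ)
substP (δ₁ ︔ δ₂)  σ = substP δ₁ σ ︔ substP δ₂ σ
substP (δ₁ ∣ δ₂)  σ = substP δ₁ σ ∣ substP δ₂ σ
substP (πx δ)     σ = πx (substP δ (liftS σ))
substP (δ *)      σ = substP δ σ *
substP (δ₁ ∥ δ₂)  σ = substP δ₁ σ ∥ substP δ₂ σ

inst : {S : Sig} {k : ℕ} → Prog S k → Vec ℕ k → Prog S 0
inst δ cs = substP δ (λ i → nm (lookup cs i))

inst1 : {S : Sig} → Prog S 1 → ℕ → Prog S 0
inst1 δ c = substP δ (λ _ → nm c)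

-- The unique interpretation of Trans and Final in a model of C whose
-- situation/fluent part is M (closed programs, i.e. under an assignment).
module ConGolog {S : Sig} (M : Model S) where

  data Final : Prog S 0 → Sit S → Set where
    fTest   : ∀ {φ s} → holds M φ s (λ ()) → Final (test φ) s
    fSeq    : ∀ {δ₁ δ₂ s} → Final δ₁ s → Final δ₂ s → Final (δ₁ ︔ δ₂) s
    fChoiceL : ∀ {δ₁ δ₂ s} → Final δ₁ s → Final (δ₁ ∣ δ₂) s
    fChoiceR : ∀ {δ₁ δ₂ s} → Final δ₂ s → Final (δ₁ ∣ δ₂) s
    fPi     : ∀ {δ s} (c : ℕ) → Final (inst1 δ c) s → Final (πx δ) s
    fStar   : ∀ {δ s} → Final (δ *) s
    fConc   : ∀ {δ₁ δ₂ s} → Final δ₁ s → Final δ₂ s → Final (δ₁ ∥ δ₂) s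

  data Trans : Prog S 0 → Sit S → Prog S 0 → Sit S → Set where
    tAct    : ∀ {A ts s} → Poss M (A , evalV ts (λ ())) s →
              Trans (act A ts) s nil (doA (A , evalV ts (λ ())) s)
    tSeqL   : ∀ {δ₁ δ₁' δ₂ s s'} → Trans δ₁ s δ₁' s' →
              Trans (δ₁ ︔ δ₂) s (δ₁' ︔ δ₂) s'
    tSeqR   : ∀ {δ₁ δ₂ δ' s s'} → Final δ₁ s → Trans δ₂ s δ' s' →
              Trans (δ₁ ︔ δ₂) s δ' s'
    tChoiceL : ∀ {δ₁ δ₂ δ' s s'} → Trans δ₁ s δ' s' → Trans (δ₁ ∣ δ₂) s δ' s'
    tChoiceR : ∀ {δ₁ δ₂ δ' s s'} → Trans δ₂ s δ' s' → Trans (δ₁ ∣ δ₂) s δ' s'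
    tPi     : ∀ {δ δ' s s'} (c : ℕ) → Trans (inst1 δ c) s δ' s' →
              Trans (πx δ) s δ' s'
    tStar   : ∀ {δ δ'' s s'} → Trans δ s δ'' s' → Trans (δ *) s (δ'' ︔ (δ *)) s'
    tConcL  : ∀ {δ₁ δ₁' δ₂ s s'} → Trans δ₁ s δ₁' s' →
              Trans (δ₁ ∥ δ₂) s (δ₁' ∥ δ₂) s'
    tConcR  : ∀ {δ₁ δ₂ δ₂' s s'} → Trans δ₂ s δ₂' s' →
              Trans (δ₁ ∥ δ₂) s (δ₁ ∥ δ₂') s'

  data Trans* : Prog S 0 → Sit S → Prog S 0 → Sit S → Set where
    refl* : ∀ {δ s} → Trans* δ s δ s
    step* : ∀ {δ s δ' s' δ'' s''} → Trans δ s δ' s' → Trans* δ' s' δ'' s'' →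
            Trans* δ s δ'' s''

  Do : Prog S 0 → Sit S → Sit S → Set
  Do δ s s' = Σ (Prog S 0) (λ δ' → Trans* δ s δ' s' × Final δ' s')

  SituationDetermined : Prog S 0 → Sit S → Set
  SituationDetermined δ s = ∀ {s' δ' δ''} →
    Trans* δ s δ' s' → Trans* δ s δ'' s' → δ' ≡ δ''

open ConGolog public

record Mapping (Sh Sl : Sig) : Set where
  field
    mAct : (A : Fin (nA Sh)) → Prog Sl (aArity Sh A)
    mFlu : (F : Fin (nF Sh)) → SFm Sl (fArity Sh F)
open Mapping public

mGround : {Sh Sl : Sig} → Mapping Sh Sl → Act Sh → Prog Sl 0
mGround m (A , cs) = inst (mAct m A) cs

mSeq : {Sh Sl : Sig} → Mapping Sh Sl → List (Act Sh) → Prog Sl 0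
mSeq m []       = nil
mSeq m (α ∷ []) = mGround m α
mSeq m (α ∷ αs@(_ ∷ _)) = mGround m α ︔ mSeq m αs

mFmA : {Sh Sl : Sig} → Mapping Sh Sl → {n : ℕ} → HAtom Sh n → SFm Sl n
mFmA m (flu F ts) = substFm substHA (mFlu m F) (λ i → lookup ts i)
mFmA m (eq t u)   = atom (eq t u)

mFm : {Sh Sl : Sig} → Mapping Sh Sl → {n : ℕ} → SFm Sh n → SFm Sl n
mFm m true       = true
mFm m (atom a)   = mFmA m a
mFm m (¬' φ)     = ¬' mFm m φ
mFm m (φ ∧' ψ)   = mFm m φ ∧' mFm m ψ
mFm m (∃' φ)     = ∃' (mFm m φ)

IsRefinement : {Sh Sl : Sig} → BAT Sl → Mapping Sh Sl → Set₁
IsRefinement {Sh} {Sl} Dl m =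
  (Ml : Model Sl) → Ml ⊨BAT Dl →
  (A : Fin (nA Sh)) (cs : Vec ℕ (aArity Sh A)) (s : Sit Sl) →
  SituationDetermined Ml (inst (mAct m A) cs) s

module _ {Sh Sl : Sig} (m : Mapping Sh Sl) (Mh : Model Sh) (Ml : Model Sl) where

  _≃m_ : Sit Sh → Sit Sl → Set
  sh ≃m sl = (F : Fin (nF Sh)) (xs : Vec ℕ (fArity Sh F)) →
             Flu Mh F xs sh ↔ holds Ml (mFlu m F) sl (tabEnv xs)

  record IsBisim (B : Sit Sh → Sit Sl → Set) : Set where
    field
      iso  : ∀ {sh sl} → B sh sl → sh ≃m sl
      forth : ∀ {sh sl} → B sh sl →
              (A : Fin (nA Sh)) (xs : Vec ℕ (aArity Sh A)) (sh' : Sit Sh) →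
              Poss Mh (A , xs) sh × sh' ≡ doA (A , xs) sh →
              Σ (Sit Sl) (λ sl' → Do Ml (mGround m (A , xs)) sl sl' × B sh' sl')
      back : ∀ {sh sl} → B sh sl →
              (A : Fin (nA Sh)) (xs : Vec ℕ (aArity Sh A)) (sl' : Sit Sl) →
              Do Ml (mGround m (A , xs)) sl sl' →
              Σ (Sit Sh) (λ sh' → Poss Mh (A , xs) sh × sh' ≡ doA (A , xs) sh × B sh' sl')

  Bisimilar : Set₁
  Bisimilar = Σ (Sit Sh → Sit Sl → Set) (λ B → IsBisim B × B S0 S0)

SoundAbstraction : {Sh Sl : Sig} → BAT Sh → BAT Sl → Mapping Sh Sl → Set₁
SoundAbstraction {Sh} {Sl} Dh Dl m =
  (Ml : Model Sl) → Ml ⊨BAT Dl →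
  Σ (Model Sh) (λ Mh → Mh ⊨BAT Dh × Bisimilar m Mh Ml)

module Submission where

-- The bisimulation witnessing soundness lets every executable high-level run
-- be replayed step by step by the low-level programs m(αᵢ), and the related
-- end situations are m-isomorphic, hence agree on φ and m(φ) respectively.

open import Defs
open import Data.Nat using (ℕ)
open import Data.Fin using (zero; suc)
open import Data.Vec using (Vec; map)
open import Data.Vec.Properties using (lookup-map; map-∘; map-cong)
open import Data.List using (List; []; _∷_)
open import Data.Product using (Σ; _×_; proj₁; proj₂) renaming (_,_ to _,,_)
open import Data.Empty using (⊥)
open import Data.Unit using (tt)
open import Function using (id; _∘_)
open import Relation.Binary.PropositionalEquality
  using (_≡_; refl; sym; trans; subst; module ≡-Reasoning)

↔-refl : ∀ {P} → P ↔ P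
↔-refl = id ,, id

↔-sym : ∀ {P Q} → P ↔ Q → Q ↔ P
↔-sym (f ,, g) = g ,, f

↔-trans : ∀ {P Q R} → P ↔ Q → Q ↔ R → P ↔ R
↔-trans (f ,, g) (f' ,, g') = f' ∘ f ,, g ∘ g'

↔-¬ : ∀ {P Q} → P ↔ Q → (P → ⊥) ↔ (Q → ⊥)
↔-¬ (f ,, g) = (_∘ g) ,, (_∘ f)

↔-× : ∀ {P Q P' Q'} → P ↔ P' → Q ↔ Q' → (P × Q) ↔ (P' × Q')
↔-× (f ,, g) (f' ,, g') = (λ (p ,, q) → f p ,, f' q) ,, (λ (p ,, q) → g p ,, g' q)

↔-Σ : ∀ {P Q : ℕ → Set} → (∀ c → P c ↔ Q c) → Σ ℕ P ↔ Σ ℕ Q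
↔-Σ eqv = (λ (c ,, p) → c ,, proj₁ (eqv c) p) ,, (λ (c ,, q) → c ,, proj₂ (eqv c) q)

_⊢_≈_ : ∀ {n m} → Subst n m → Env m → Env n → Set
σ ⊢ ρ ≈ ρ' = ∀ i → evalT (σ i) ρ ≡ ρ' i

evalT-substT : ∀ {n m} {σ : Subst n m} {ρ ρ'} → σ ⊢ ρ ≈ ρ' →
               (t : Tm n) → evalT (substT t σ) ρ ≡ evalT t ρ'
evalT-substT agree (var i) = agree i
evalT-substT agree (nm c)  = refl

evalV-substT : ∀ {n m k} {σ : Subst n m} {ρ ρ'} → σ ⊢ ρ ≈ ρ' →
               (ts : Vec (Tm n) k) → evalV (map (λ t → substT t σ) ts) ρ ≡ evalV ts ρ'
evalV-substT {σ = σ} {ρ} {ρ'} agree ts = begin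
  map (λ t → evalT t ρ) (map (λ t → substT t σ) ts)  ≡⟨ map-∘ _ _ ts ⟨
  map (λ t → evalT (substT t σ) ρ) ts                 ≡⟨ map-cong (evalT-substT agree) ts ⟩
  map (λ t → evalT t ρ') ts                           ∎
  where open ≡-Reasoning

liftS-agrees : ∀ {n m} {σ : Subst n m} {ρ ρ'} → σ ⊢ ρ ≈ ρ' →
               (c : ℕ) → liftS σ ⊢ ext ρ c ≈ ext ρ' c
liftS-agrees agree c zero = refl
liftS-agrees {σ = σ} agree c (suc i) with σ i | agree i
... | var _ | e = e
... | nm _  | e = e

holds-substFm : ∀ {S} (M : Model S) (s : Sit S) {n m} {σ : Subst n m} {ρ ρ'} →
                σ ⊢ ρ ≈ ρ' → (ψ : SFm S n) →
                holds M (substFm substHA ψ σ) s ρ ↔ holds M ψ s ρ'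
holds-substFm M s agree true = ↔-refl
holds-substFm M s agree (atom (flu F ts)) =
  subst (λ xs → Flu M F xs s) e ,, subst (λ xs → Flu M F xs s) (sym e)
  where e = evalV-substT agree ts
holds-substFm M s agree (atom (eq t u)) =
  (λ p → trans (sym (et t)) (trans p (et u))) ,, (λ p → trans (et t) (trans p (sym (et u))))
  where et = evalT-substT agree
holds-substFm M s agree (¬' ψ)   = ↔-¬ (holds-substFm M s agree ψ)
holds-substFm M s agree (ψ ∧' χ) = ↔-× (holds-substFm M s agree ψ) (holds-substFm M s agree χ)
holds-substFm M s agree (∃' ψ)   = ↔-Σ (λ c → holds-substFm M s (liftS-agrees agree c) ψ)

module _ {Sh Sl : Sig} (m : Mapping Sh Sl) (Mh : Model Sh) (Ml : Model Sl) where

  ≃m⇒holds-mFm : ∀ {sh sl} → _≃m_ m Mh Ml sh sl → ∀ {n} (φ : SFm Sh n) (ρ : Env n) →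
                 holds Mh φ sh ρ ↔ holds Ml (mFm m φ) sl ρ
  ≃m⇒holds-mFm iso true            ρ = ↔-refl
  ≃m⇒holds-mFm {sl = sl} iso (atom (flu F ts)) ρ =
    ↔-trans (iso F (evalV ts ρ))
            (↔-sym (holds-substFm Ml sl (λ i → sym (lookup-map i _ ts)) (mFlu m F)))
  ≃m⇒holds-mFm iso (atom (eq t u)) ρ = ↔-refl
  ≃m⇒holds-mFm iso (¬' φ)          ρ = ↔-¬ (≃m⇒holds-mFm iso φ ρ)
  ≃m⇒holds-mFm iso (φ ∧' ψ)        ρ = ↔-× (≃m⇒holds-mFm iso φ ρ) (≃m⇒holds-mFm iso ψ ρ)
  ≃m⇒holds-mFm iso (∃' φ)          ρ = ↔-Σ (λ c → ≃m⇒holds-mFm iso φ (ext ρ c))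

module _ {S : Sig} (M : Model S) where

  Trans*-trans : ∀ {δ₁ s₁ δ₂ s₂ δ₃ s₃} →
                 Trans* M δ₁ s₁ δ₂ s₂ → Trans* M δ₂ s₂ δ₃ s₃ → Trans* M δ₁ s₁ δ₃ s₃
  Trans*-trans refl*        r = r
  Trans*-trans (step* t r₁) r = step* t (Trans*-trans r₁ r)

  Trans*-︔ˡ : ∀ {δ₁ δ₁' δ₂ s s'} →
              Trans* M δ₁ s δ₁' s' → Trans* M (δ₁ ︔ δ₂) s (δ₁' ︔ δ₂) s'
  Trans*-︔ˡ refl*       = refl*
  Trans*-︔ˡ (step* t r) = step* (tSeqL t) (Trans*-︔ˡ r)

  Do-︔ : ∀ {δ₁ δ₂ s₀ s₁ s₂} → Do M δ₁ s₀ s₁ → Do M δ₂ s₁ s₂ → Do M (δ₁ ︔ δ₂) s₀ s₂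
  Do-︔ (δ₁' ,, r₁ ,, f₁) (δ₂' ,, refl*     ,, f₂) = δ₁' ︔ _ ,, Trans*-︔ˡ r₁ ,, fSeq f₁ f₂
  Do-︔ (δ₁' ,, r₁ ,, f₁) (δ₂' ,, step* t r₂ ,, f₂) =
    δ₂' ,, Trans*-trans (Trans*-︔ˡ r₁) (step* (tSeqR f₁ t) r₂) ,, f₂

  Do-nil : ∀ {s} → Do M nil s s
  Do-nil = nil ,, refl* ,, fTest tt

Executable-doSeq⁻ : ∀ {S} (M : Model S) (as : List (Act S)) (s : Sit S) →
                    Executable M (doSeq as s) → Executable M s
Executable-doSeq⁻ M []       s e = e
Executable-doSeq⁻ M (a ∷ as) s e = proj₁ (Executable-doSeq⁻ M as (a ∷ s) e)

module _ {Sh Sl : Sig} {m : Mapping Sh Sl} {Mh : Model Sh} {Ml : Model Sl}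
         {B : Sit Sh → Sit Sl → Set} (bisim : IsBisim m Mh Ml B) where
  open IsBisim bisim

  IsBisim-run : (αs : List (Act Sh)) {sh : Sit Sh} {sl : Sit Sl} → B sh sl →
                Executable Mh (doSeq αs sh) →
                Σ (Sit Sl) (λ sl' → Do Ml (mSeq m αs) sl sl' × B (doSeq αs sh) sl')
  IsBisim-run []                  {sl = sl} b e = sl ,, Do-nil Ml ,, b
  IsBisim-run ((A , xs) ∷ [])     b e = forth b A xs _ (proj₂ e ,, refl)
  IsBisim-run (α@(A , xs) ∷ β ∷ βs) {sh} b e =
    let sl₁ ,, d₁ ,, b₁ = forth b A xs _ (proj₂ (Executable-doSeq⁻ Mh (β ∷ βs) (α ∷ sh) e) ,, refl)
        sl₂ ,, d₂ ,, b₂ = IsBisim-run (β ∷ βs) b₁ e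
    in sl₂ ,, Do-︔ Ml d₁ d₂ ,, b₂

theorem2 : {Sh Sl : Sig} (Dh : BAT Sh) (Dl : BAT Sl) (m : Mapping Sh Sl) →
    IsRefinement Dl m →
    SoundAbstraction Dh Dl m →
    (αs : List (Act Sh)) {n : ℕ} (φ : SFm Sh n) →
    ((Mh : Model Sh) → Mh ⊨BAT Dh → (ρ : Env n) →
    Executable Mh (doSeq αs S0) × holds Mh φ (doSeq αs S0) ρ) →
    (Ml : Model Sl) → Ml ⊨BAT Dl → (ρ : Env n) →
    Σ (Sit Sl) (λ s → Do Ml (mSeq m αs) S0 s × holds Ml (mFm m φ) s ρ)
theorem2 Dh Dl m _ sound αs φ entailed Ml Ml⊨Dl ρ
  with sound Ml Ml⊨Dl
... | Mh ,, Mh⊨Dh ,, B ,, bisim ,, initial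
  with entailed Mh Mh⊨Dh ρ
... | executable ,, φ-holds
  with IsBisim-run bisim αs initial executable
... | sl ,, run ,, related =
  sl ,, run ,, proj₁ (≃m⇒holds-mFm m Mh Ml (IsBisim.iso bisim related) φ ρ) φ-holds
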